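{- Let $p\ge 1$ and $r\ge 1$ be integers. Then, as formal power series, $$(v-1-tv(1-u))\,G^{(p)}_r(t,u,v,z)=t^{r+1}z^ruv(v^p-1)+t\big((v-1)z-v\big)G^{(p)}_r(t,u,1,z)+tuv^{p+1}G^{(p)}_r(t,uv,1,z).$$
   Context: For a finite integer sequence $(a_1,\dots,a_i)$, $\mathrm{asc}(a_1,\dots,a_i)=|\{j:1\le j<i,\ a_j<a_{j+1}\}|$. For an integer $p\ge1$, a $p$-ascent sequence of length $n\ge1$ is a sequence $(a_1,\dots,a_n)$ of nonnegative integers with $a_1=0$ and $a_i\le p+\mathrm{asc}(a_1,\dots,a_{i-1})$ for all $2\le i\le n$; the empty word is also considered a $p$-ascent sequence. For a sequence $w$, $|w|$ is its length, $\mathrm{asc}(w)$ its number of ascents, $\mathrm{last}(w)$ its last letter, and $|w|_0$ its number of zeros. For $r\ge1$, $G^{(p)}_r(t,u,v,z)=\sum_w t^{|w|}u^{\mathrm{asc}(w)}v^{\mathrm{last}(w)}z^{|w|_0}$, where the sum is over all $p$-ascent sequences $w$ that begin with exactly $r$ zeros followed by a nonzero letter (necessarily in $\{1,\dots,p\}$). -}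

module Defs where

open import Level using (Level)
open import Data.Nat using (ℕ; zero; suc; _<ᵇ_; _≡ᵇ_) renaming (_+_ to _+ℕ_)
open import Data.Bool using (Bool; true; false; _∧_; not; if_then_else_)
open import Data.List using (List; []; _∷_; map; concatMap; filterᵇ; foldr; replicate; _++_; upTo; length; take; drop)
open import Algebra.Bundles using (CommutativeRing)
import Algebra.Definitions.RawSemiring as RS

asc : List ℕ → ℕ
asc []           = 0
asc (x ∷ [])     = 0
asc (x ∷ y ∷ w)  = (if x <ᵇ y then 1 else 0) +ℕ asc (y ∷ w)

-- last letter (convention last [] = 0; only used on nonempty words)
lastL : List ℕ → ℕ
lastL []          = 0
lastL (x ∷ [])    = x
lastL (x ∷ y ∷ w) = lastL (y ∷ w)

zeros : List ℕ → ℕ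
zeros []      = 0
zeros (x ∷ w) = (if x ≡ᵇ 0 then 1 else 0) +ℕ zeros w

-- checks a_i ≤ p + asc(a_1..a_{i-1}) for i ≥ 2, given the previous letter
-- and the number of ascents so far
ascOK : ℕ → ℕ → ℕ → List ℕ → Bool
ascOK p prev k []      = true
ascOK p prev k (x ∷ w) =
  (x <ᵇ suc (p +ℕ k)) ∧ ascOK p x ((if prev <ᵇ x then 1 else 0) +ℕ k) w

isPAscent : ℕ → List ℕ → Bool
isPAscent p []      = true
isPAscent p (x ∷ w) = (x ≡ᵇ 0) ∧ ascOK p x 0 w

startsR : ℕ → List ℕ → Bool
startsR r w = allZ (take r w) ∧ nz (drop r w)
  where
  allZ : List ℕ → Bool
  allZ []      = true
  allZ (x ∷ l) = (x ≡ᵇ 0) ∧ allZ l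
  nz : List ℕ → Bool
  nz []      = false
  nz (x ∷ _) = not (x ≡ᵇ 0)

words : ℕ → ℕ → List (List ℕ)
words B zero    = [] ∷ []
words B (suc n) = concatMap (λ w → map (λ x → x ∷ w) (upTo B)) (words B n)

-- all words of length n counted by G^{(p)}_r.  Every letter of a
-- p-ascent sequence of length n is ≤ p + n, so the bound B = suc (p + n)
-- loses nothing.
seqs : ℕ → ℕ → ℕ → List (List ℕ)
seqs p r n = filterᵇ (λ w → isPAscent p w ∧ startsR r w) (words (suc (p +ℕ n)) n)

-- A formal power series in t is represented by its coefficient sequence
-- ℕ → Carrier; G p r u v z n is the coefficient of t^n in
-- G^{(p)}_r(t,u,v,z), i.e. Σ_{w, |w|=n} u^asc(w) v^last(w) z^|w|_0.

module GF {c ℓ : Level} (R : CommutativeRing c ℓ) where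
  open CommutativeRing R
  open import Algebra.Bundles using (Semiring)
  open RS (Semiring.rawSemiring semiring) public using (_^_)

  sumR : List Carrier → Carrier
  sumR = foldr _+_ 0#

  G : ℕ → ℕ → Carrier → Carrier → Carrier → ℕ → Carrier
  G p r u v z n =
    sumR (map (λ w → (u ^ asc w) * ((v ^ lastL w) * (z ^ zeros w))) (seqs p r n))

  shiftT : (ℕ → Carrier) → ℕ → Carrier
  shiftT f zero    = 0#
  shiftT f (suc n) = f n

  monoT : ℕ → Carrier → ℕ → Carrier
  monoT m a n = if m ≡ᵇ n then a else 0#

-- Split a counted word of length n + 1 as w ++ [ x ] and sum over the last letter x for a fixed
-- prefix w of length n.  Appending x multiplies the weight u^asc v^last z^zeros of w by
-- u^[last w < x] v^(x − last w) z^[x = 0], and x runs over 0 … p + asc w: a geometric sum in v,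
-- which telescopes after multiplication by v − 1.  For a counted prefix (n > r) what remains,
-- after subtracting v(1 − u) times the weight of w, is ((v − 1)z − v) times the weight of w at
-- v = 1 plus u v^(p+1) times its weight at (uv, 1).  For n = r the only prefix is 0^r, x runs
-- over 1 … p, and the sum yields the monomial t^(r+1) z^r u v (v^p − 1).  Summing over all
-- prefixes w gives the identity coefficientwise.

module Submission where

open import Defs
open import Level using (Level)
open import Data.Nat using (ℕ; suc; _≥_)
open import Algebra.Bundles using (CommutativeRing)

-- Tactic.RingSolver takes the ring itself as its coefficients and so cannot see v - v ≈ 0 in an
-- abstract ring; this solver uses integer coefficients instead.
module DifferenceRingSolver {c ℓ : Level} (R : CommutativeRing c ℓ) where
  open import Level using (0ℓ)
  open import Algebra.Bundles using (RawRing)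
  open import Data.Nat as ℕ using (ℕ; zero; suc)
  import Data.Nat.Properties as ℕ
  open import Data.Product using (_×_; _,_)
  open import Data.Maybe using (Maybe; just; nothing)
  open import Relation.Nullary using (yes; no)
  open import Relation.Binary.PropositionalEquality as ≡ using (_≡_)
  open CommutativeRing R
  open import Algebra.Properties.Semiring.Mult.TCOptimised semiring
    using (×-homo-+; ×1-homo-*) renaming (_×_ to _·_)
  open import Algebra.Properties.Ring ring
    using (x[y-z]≈xy-xz; [y-z]x≈yx-zx; -‿+-comm; ⁻¹-anti-homo‿-; -0#≈0#; x∙y⁻¹≈ε⇒x≈y)
  open import Algebra.Properties.CommutativeSemigroup +-commutativeSemigroup
    using (interchange)
  open import Algebra.Solver.Ring.AlmostCommutativeRing
    using (_-Raw-AlmostCommutative⟶_; fromCommutativeRing)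
  open import Relation.Binary.Reasoning.Setoid setoid
  import Algebra.Solver.Ring

  private
    [x-y]+[z-w]≈[x+z]-[y+w] : ∀ x y z w → (x - y) + (z - w) ≈ (x + z) - (y + w)
    [x-y]+[z-w]≈[x+z]-[y+w] x y z w = trans (interchange x (- y) z (- w)) (+-congˡ (-‿+-comm y w))

    [x-y]-[z-w]≈[x+w]-[y+z] : ∀ x y z w → (x - y) - (z - w) ≈ (x + w) - (y + z)
    [x-y]-[z-w]≈[x+w]-[y+z] x y z w = trans (+-congˡ (⁻¹-anti-homo‿- z w)) ([x-y]+[z-w]≈[x+z]-[y+w] x y w z)

  -- The integers as pairs (a , b) standing for a − b.  The operations return
  -- canonical pairs, so that equal integers are equal pairs: the solver's final
  -- step compares the evaluated normal forms definitionally.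
  canonical : ℕ × ℕ → ℕ × ℕ
  canonical (a , b) = (a ℕ.∸ b , b ℕ.∸ a)

  differences : RawRing 0ℓ 0ℓ
  differences = record
    { Carrier = ℕ × ℕ
    ; _≈_     = _≡_
    ; _+_     = λ { (a , b) (c , d) → canonical (a ℕ.+ c , b ℕ.+ d) }
    ; _*_     = λ { (a , b) (c , d) → canonical (a ℕ.* c ℕ.+ b ℕ.* d , a ℕ.* d ℕ.+ b ℕ.* c) }
    ; -_      = λ { (a , b) → (b , a) }
    ; 0#      = (0 , 0)
    ; 1#      = (1 , 0)
    }

  -- Split on b so that (1 , 0) and (0 , 0) denote 1# and 0# definitionally.
  ⟦_⟧ᵈ : ℕ × ℕ → Carrier
  ⟦ a , zero ⟧ᵈ  = a · 1#
  ⟦ a , suc b ⟧ᵈ = a · 1# - suc b · 1#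

  ⟦⟧ᵈ-difference : ∀ a b → ⟦ a , b ⟧ᵈ ≈ a · 1# - b · 1#
  ⟦⟧ᵈ-difference a zero    = sym (trans (+-congˡ -0#≈0#) (+-identityʳ _))
  ⟦⟧ᵈ-difference a (suc b) = refl

  ⟦⟧ᵈ-cong : ∀ a b c d → a ℕ.+ d ≡ c ℕ.+ b → ⟦ a , b ⟧ᵈ ≈ ⟦ c , d ⟧ᵈ
  ⟦⟧ᵈ-cong a b c d eq = begin
    ⟦ a , b ⟧ᵈ        ≈⟨ ⟦⟧ᵈ-difference a b ⟩
    a · 1# - b · 1#   ≈⟨ x∙y⁻¹≈ε⇒x≈y _ _ (begin
        (a · 1# - b · 1#) - (c · 1# - d · 1#)   ≈⟨ [x-y]-[z-w]≈[x+w]-[y+z] _ _ _ _ ⟩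
        (a · 1# + d · 1#) - (b · 1# + c · 1#)
          ≈⟨ +-cong (sym (×-homo-+ 1# a d)) (-‿cong (trans (+-comm _ _) (sym (×-homo-+ 1# c b)))) ⟩
        (a ℕ.+ d) · 1# - (c ℕ.+ b) · 1#         ≡⟨ ≡.cong (λ n → n · 1# - (c ℕ.+ b) · 1#) eq ⟩
        (c ℕ.+ b) · 1# - (c ℕ.+ b) · 1#         ≈⟨ -‿inverseʳ _ ⟩
        0#                                       ∎) ⟩
    c · 1# - d · 1#   ≈⟨ ⟦⟧ᵈ-difference c d ⟨
    ⟦ c , d ⟧ᵈ        ∎

  ⟦⟧ᵈ-canonical : ∀ a b → ⟦ canonical (a , b) ⟧ᵈ ≈ ⟦ a , b ⟧ᵈ
  ⟦⟧ᵈ-canonical a b = ⟦⟧ᵈ-cong (a ℕ.∸ b) (b ℕ.∸ a) a b (∸+≡+∸ a b)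
    where
    ∸+≡+∸ : ∀ a b → a ℕ.∸ b ℕ.+ b ≡ a ℕ.+ (b ℕ.∸ a)
    ∸+≡+∸ zero    zero    = ≡.refl
    ∸+≡+∸ zero    (suc b) = ≡.refl
    ∸+≡+∸ (suc a) zero    = ≡.refl
    ∸+≡+∸ (suc a) (suc b) = ≡.trans (ℕ.+-suc (a ℕ.∸ b) b) (≡.cong suc (∸+≡+∸ a b))

  ⟦⟧ᵈ-+ : ∀ a b c d → ⟦ canonical (a ℕ.+ c , b ℕ.+ d) ⟧ᵈ ≈ ⟦ a , b ⟧ᵈ + ⟦ c , d ⟧ᵈ
  ⟦⟧ᵈ-+ a b c d = begin
    ⟦ canonical (a ℕ.+ c , b ℕ.+ d) ⟧ᵈ      ≈⟨ ⟦⟧ᵈ-canonical (a ℕ.+ c) (b ℕ.+ d) ⟩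
    ⟦ a ℕ.+ c , b ℕ.+ d ⟧ᵈ                  ≈⟨ ⟦⟧ᵈ-difference (a ℕ.+ c) (b ℕ.+ d) ⟩
    (a ℕ.+ c) · 1# - (b ℕ.+ d) · 1#         ≈⟨ +-cong (×-homo-+ 1# a c) (-‿cong (×-homo-+ 1# b d)) ⟩
    (a · 1# + c · 1#) - (b · 1# + d · 1#)   ≈⟨ [x-y]+[z-w]≈[x+z]-[y+w] _ _ _ _ ⟨
    (a · 1# - b · 1#) + (c · 1# - d · 1#)   ≈⟨ +-cong (⟦⟧ᵈ-difference a b) (⟦⟧ᵈ-difference c d) ⟨
    ⟦ a , b ⟧ᵈ + ⟦ c , d ⟧ᵈ                 ∎

  ⟦⟧ᵈ-* : ∀ a b c d →
          ⟦ canonical (a ℕ.* c ℕ.+ b ℕ.* d , a ℕ.* d ℕ.+ b ℕ.* c) ⟧ᵈ ≈ ⟦ a , b ⟧ᵈ * ⟦ c , d ⟧ᵈ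
  ⟦⟧ᵈ-* a b c d = begin
    ⟦ canonical (ac+bd , ad+bc) ⟧ᵈ       ≈⟨ ⟦⟧ᵈ-canonical ac+bd ad+bc ⟩
    ⟦ ac+bd , ad+bc ⟧ᵈ                   ≈⟨ ⟦⟧ᵈ-difference ac+bd ad+bc ⟩
    ac+bd · 1# - ad+bc · 1#
      ≈⟨ +-cong (trans (×-homo-+ 1# (a ℕ.* c) (b ℕ.* d)) (+-cong (×1-homo-* a c) (×1-homo-* b d)))
                (-‿cong (trans (×-homo-+ 1# (a ℕ.* d) (b ℕ.* c)) (+-cong (×1-homo-* a d) (×1-homo-* b c)))) ⟩
    (A * C + B * D) - (A * D + B * C)    ≈⟨ [x-y]-[z-w]≈[x+w]-[y+z] _ _ _ _ ⟨
    (A * C - A * D) - (B * C - B * D)    ≈⟨ +-cong (x[y-z]≈xy-xz A C D) (-‿cong (x[y-z]≈xy-xz B C D)) ⟨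
    A * (C - D) - B * (C - D)            ≈⟨ [y-z]x≈yx-zx (C - D) A B ⟨
    (A - B) * (C - D)                    ≈⟨ *-cong (⟦⟧ᵈ-difference a b) (⟦⟧ᵈ-difference c d) ⟨
    ⟦ a , b ⟧ᵈ * ⟦ c , d ⟧ᵈ              ∎
    where ac+bd = a ℕ.* c ℕ.+ b ℕ.* d; ad+bc = a ℕ.* d ℕ.+ b ℕ.* c
          A = a · 1#; B = b · 1#; C = c · 1#; D = d · 1#

  ⟦⟧ᵈ-homomorphism : differences -Raw-AlmostCommutative⟶ fromCommutativeRing R
  ⟦⟧ᵈ-homomorphism = record
    { ⟦_⟧    = ⟦_⟧ᵈ
    ; +-homo = λ { (a , b) (c , d) → ⟦⟧ᵈ-+ a b c d }
    ; *-homo = λ { (a , b) (c , d) → ⟦⟧ᵈ-* a b c d }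
    ; -‿homo = λ { (a , b) → trans (⟦⟧ᵈ-difference b a)
                    (trans (sym (⁻¹-anti-homo‿- _ _)) (-‿cong (sym (⟦⟧ᵈ-difference a b)))) }
    ; 0-homo = refl
    ; 1-homo = refl
    }

  ⟦⟧ᵈ-equal? : ∀ x y → Maybe (⟦ x ⟧ᵈ ≈ ⟦ y ⟧ᵈ)
  ⟦⟧ᵈ-equal? (a , b) (c , d) with a ℕ.+ d ℕ.≟ c ℕ.+ b
  ... | yes eq = just (⟦⟧ᵈ-cong a b c d eq)
  ... | no _   = nothing

  open Algebra.Solver.Ring differences (fromCommutativeRing R) ⟦⟧ᵈ-homomorphism ⟦⟧ᵈ-equal? public

  :0 :1 : ∀ {n} → Polynomial n
  :0 = con (0 , 0)
  :1 = con (1 , 0)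

module Words where
  open import Data.Nat using (ℕ; zero; suc; _+_; _≤_; _<_; _<ᵇ_; _≡ᵇ_; z≤n; s≤s; z<s)
  open import Data.Nat.Properties
    using (≤-refl; ≤-reflexive; ≤-trans; ≤-pred; <⇒≯; ≤⇒≯; m≤m+n; m≤n+m; +-suc; +-assoc; +-identityʳ;
           +-mono-≤; +-monoˡ-≤; +-monoʳ-≤; <⇒<ᵇ; <ᵇ⇒<; ≡⇒≡ᵇ; ≡ᵇ⇒≡; +-commutativeSemigroup)
  open import Data.Bool using (Bool; true; false; T; not; _∧_; if_then_else_)
  open import Data.Bool.Properties using (∧-assoc; ∧-comm; ∧-zeroʳ; ∧-identityʳ; T-≡)
  open import Data.List using (List; []; _∷_; _++_; [_]; map; upTo; length; replicate)
  open import Data.List.Properties using (length-replicate)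
  open import Data.List.Membership.Propositional using (_∈_; find)
  open import Data.List.Membership.Propositional.Properties using (∈-map⁻; ∈-concatMap⁻)
  open import Data.List.Relation.Unary.Any using (here; there)
  open import Data.Product using (_×_; _,_; proj₁; proj₂)
  open import Function.Bundles using (Equivalence)
  open import Relation.Nullary using (contradiction)
  open import Relation.Binary.PropositionalEquality hiding ([_])
  open import Algebra.Properties.CommutativeSemigroup +-commutativeSemigroup using (x∙yz≈yx∙z)

  𝟙 : Bool → ℕ
  𝟙 b = if b then 1 else 0

  𝟙≤1 : ∀ b → 𝟙 b ≤ 1
  𝟙≤1 true  = ≤-refl
  𝟙≤1 false = z≤n

  isZeroWord : List ℕ → Bool
  isZeroWord []      = true
  isZeroWord (x ∷ w) = (x ≡ᵇ 0) ∧ isZeroWord w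

  counted : ℕ → ℕ → List ℕ → Bool
  counted p r w = isPAscent p w ∧ startsR r w

  <ᵇ-true : ∀ {m n} → m < n → (m <ᵇ n) ≡ true
  <ᵇ-true m<n = Equivalence.to T-≡ (<⇒<ᵇ m<n)

  <ᵇ-sound : ∀ {m n} → (m <ᵇ n) ≡ true → m < n
  <ᵇ-sound {m} {n} eq = <ᵇ⇒< m n (Equivalence.from T-≡ eq)

  <ᵇ-false : ∀ {m n} → n ≤ m → (m <ᵇ n) ≡ false
  <ᵇ-false {m} {n} n≤m with m <ᵇ n in eq
  ... | false = refl
  ... | true  = contradiction (<ᵇ-sound eq) (≤⇒≯ n≤m)

  ≡ᵇ-sound : ∀ {m n} → (m ≡ᵇ n) ≡ true → m ≡ n
  ≡ᵇ-sound {m} {n} eq = ≡ᵇ⇒≡ m n (Equivalence.from T-≡ eq)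

  ≡ᵇ-refl : ∀ n → (n ≡ᵇ n) ≡ true
  ≡ᵇ-refl n = Equivalence.to T-≡ (≡⇒≡ᵇ n n refl)

  ≡ᵇ-false : ∀ {m n} → m ≢ n → (m ≡ᵇ n) ≡ false
  ≡ᵇ-false {m} {n} m≢n with m ≡ᵇ n in eq
  ... | false = refl
  ... | true  = contradiction (≡ᵇ-sound eq) m≢n

  ∧-true : ∀ {a b} → a ∧ b ≡ true → a ≡ true × b ≡ true
  ∧-true {true} {true} _ = refl , refl

  ascOK-letter≤ : ∀ {p prev k l x} → ascOK p prev k l ≡ true → x ∈ l → x ≤ p + (k + length l)
  ascOK-letter≤ {p} {k = k} {y ∷ l} ok (here refl) =
    ≤-trans (≤-pred (<ᵇ-sound (proj₁ (∧-true ok)))) (+-monoʳ-≤ p (m≤m+n k _))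
  ascOK-letter≤ {p} {prev} {k} {y ∷ l} ok (there x∈l) =
    ≤-trans (ascOK-letter≤ (proj₂ (∧-true ok)) x∈l)
            (+-monoʳ-≤ p (≤-trans (+-monoˡ-≤ (length l) (+-monoˡ-≤ k (𝟙≤1 (prev <ᵇ y))))
                                  (≤-reflexive (sym (+-suc k (length l))))))

  isPAscent-letter< : ∀ {p w x} → isPAscent p w ≡ true → x ∈ w → x < p + length w
  isPAscent-letter< {p} {y ∷ l} ok (here refl) =
    subst₂ _<_ (sym (≡ᵇ-sound (proj₁ (∧-true ok)))) (sym (+-suc p (length l))) z<s
  isPAscent-letter< {p} {y ∷ l} {x} ok (there x∈l) =
    subst (x <_) (sym (+-suc p (length l))) (s≤s (ascOK-letter≤ (proj₂ (∧-true ok)) x∈l))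

  counted-∋-large : ∀ {p r w B} → p + length w < B → B ∈ w → counted p r w ≡ false
  counted-∋-large {p} {w = w} large B∈w with isPAscent p w in eq
  ... | false = refl
  ... | true  = contradiction (isPAscent-letter< eq B∈w) (<⇒≯ large)

  ascOK-lastL≤ : ∀ {p prev k} l → ascOK p prev k l ≡ true → prev ≤ p + k →
                 lastL (prev ∷ l) ≤ p + (asc (prev ∷ l) + k)
  ascOK-lastL≤ []      _  prev≤ = prev≤
  ascOK-lastL≤ {p} {prev} {k} (y ∷ l) ok _ =
    subst (λ m → lastL (y ∷ l) ≤ p + m) (x∙yz≈yx∙z (asc (y ∷ l)) (𝟙 (prev <ᵇ y)) k)
          (ascOK-lastL≤ l (proj₂ (∧-true ok))
            (≤-trans (≤-pred (<ᵇ-sound (proj₁ (∧-true ok)))) (+-monoʳ-≤ p (m≤n+m k _))))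

  isPAscent-lastL≤ : ∀ {p} w → isPAscent p w ≡ true → lastL w ≤ p + asc w
  isPAscent-lastL≤ [] _ = z≤n
  isPAscent-lastL≤ {p} (y ∷ l) ok =
    subst (λ m → lastL (y ∷ l) ≤ p + m) (+-identityʳ _)
          (ascOK-lastL≤ l (proj₂ (∧-true ok)) (≤-trans (≤-reflexive (≡ᵇ-sound (proj₁ (∧-true ok)))) z≤n))

  asc≤length : ∀ w → asc w ≤ length w
  asc≤length []          = z≤n
  asc≤length (x ∷ [])    = z≤n
  asc≤length (x ∷ y ∷ w) = +-mono-≤ (𝟙≤1 (x <ᵇ y)) (asc≤length (y ∷ w))

  ascOK-∷ʳ : ∀ {p} prev k l x →
             ascOK p prev k (l ++ [ x ]) ≡ ascOK p prev k l ∧ (x <ᵇ suc (p + (asc (prev ∷ l) + k)))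
  ascOK-∷ʳ prev k []      x = ∧-identityʳ _
  ascOK-∷ʳ {p} prev k (y ∷ l) x = begin
    (y <ᵇ suc (p + k)) ∧ ascOK p y k′ (l ++ [ x ])
      ≡⟨ cong ((y <ᵇ suc (p + k)) ∧_) (ascOK-∷ʳ y k′ l x) ⟩
    (y <ᵇ suc (p + k)) ∧ (ascOK p y k′ l ∧ (x <ᵇ suc (p + (asc (y ∷ l) + k′))))
      ≡⟨ ∧-assoc (y <ᵇ suc (p + k)) _ _ ⟨
    ((y <ᵇ suc (p + k)) ∧ ascOK p y k′ l) ∧ (x <ᵇ suc (p + (asc (y ∷ l) + k′)))
      ≡⟨ cong (λ m → ((y <ᵇ suc (p + k)) ∧ ascOK p y k′ l) ∧ (x <ᵇ suc (p + m)))
              (x∙yz≈yx∙z (asc (y ∷ l)) (𝟙 (prev <ᵇ y)) k) ⟩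
    ((y <ᵇ suc (p + k)) ∧ ascOK p y k′ l) ∧ (x <ᵇ suc (p + (asc (prev ∷ y ∷ l) + k))) ∎
    where open ≡-Reasoning
          k′ = 𝟙 (prev <ᵇ y) + k

  isPAscent-∷ʳ : ∀ {p} w x → w ≢ [] →
                 isPAscent p (w ++ [ x ]) ≡ isPAscent p w ∧ (x <ᵇ suc (p + asc w))
  isPAscent-∷ʳ []      x w≢[] = contradiction refl w≢[]
  isPAscent-∷ʳ {p} (y ∷ l) x _ = begin
    (y ≡ᵇ 0) ∧ ascOK p y 0 (l ++ [ x ])
      ≡⟨ cong ((y ≡ᵇ 0) ∧_) (ascOK-∷ʳ y 0 l x) ⟩
    (y ≡ᵇ 0) ∧ (ascOK p y 0 l ∧ (x <ᵇ suc (p + (asc (y ∷ l) + 0))))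
      ≡⟨ ∧-assoc (y ≡ᵇ 0) _ _ ⟨
    isPAscent p (y ∷ l) ∧ (x <ᵇ suc (p + (asc (y ∷ l) + 0)))
      ≡⟨ cong (λ m → isPAscent p (y ∷ l) ∧ (x <ᵇ suc (p + m))) (+-identityʳ _) ⟩
    isPAscent p (y ∷ l) ∧ (x <ᵇ suc (p + asc (y ∷ l))) ∎
    where open ≡-Reasoning

  asc-∷ʳ : ∀ w x → w ≢ [] → asc (w ++ [ x ]) ≡ asc w + 𝟙 (lastL w <ᵇ x)
  asc-∷ʳ []          x w≢[] = contradiction refl w≢[]
  asc-∷ʳ (y ∷ [])    x _    = +-identityʳ _
  asc-∷ʳ (y ∷ y′ ∷ l) x _   =
    trans (cong (𝟙 (y <ᵇ y′) +_) (asc-∷ʳ (y′ ∷ l) x (λ ()))) (sym (+-assoc (𝟙 (y <ᵇ y′)) _ _))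

  lastL-∷ʳ : ∀ w x → lastL (w ++ [ x ]) ≡ x
  lastL-∷ʳ []           x = refl
  lastL-∷ʳ (y ∷ [])     x = refl
  lastL-∷ʳ (y ∷ y′ ∷ l) x = lastL-∷ʳ (y′ ∷ l) x

  zeros-∷ʳ : ∀ w x → zeros (w ++ [ x ]) ≡ zeros w + 𝟙 (x ≡ᵇ 0)
  zeros-∷ʳ []      x = +-identityʳ _
  zeros-∷ʳ (y ∷ l) x = trans (cong (𝟙 (y ≡ᵇ 0) +_) (zeros-∷ʳ l x)) (sym (+-assoc (𝟙 (y ≡ᵇ 0)) _ _))

  startsR-∷ : ∀ r x w → startsR (suc r) (x ∷ w) ≡ (x ≡ᵇ 0) ∧ startsR r w
  startsR-∷ r x w = ∧-assoc (x ≡ᵇ 0) _ _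

  startsR-short : ∀ r w → length w ≤ r → startsR r w ≡ false
  startsR-short zero    []      _       = refl
  startsR-short (suc r) []      _       = refl
  startsR-short (suc r) (x ∷ w) (s≤s h) =
    trans (startsR-∷ r x w) (trans (cong ((x ≡ᵇ 0) ∧_) (startsR-short r w h)) (∧-zeroʳ _))

  startsR-++-long : ∀ r w ys → r < length w → startsR r (w ++ ys) ≡ startsR r w
  startsR-++-long zero    (x ∷ w) ys _       = refl
  startsR-++-long (suc r) (x ∷ w) ys (s≤s h) = begin
    startsR (suc r) (x ∷ w ++ ys)   ≡⟨ startsR-∷ r x (w ++ ys) ⟩
    (x ≡ᵇ 0) ∧ startsR r (w ++ ys)  ≡⟨ cong ((x ≡ᵇ 0) ∧_) (startsR-++-long r w ys h) ⟩
    (x ≡ᵇ 0) ∧ startsR r w          ≡⟨ startsR-∷ r x w ⟨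
    startsR (suc r) (x ∷ w)         ∎
    where open ≡-Reasoning

  startsR-∷ʳ-exact : ∀ w x → startsR (length w) (w ++ [ x ]) ≡ isZeroWord w ∧ not (x ≡ᵇ 0)
  startsR-∷ʳ-exact []      x = refl
  startsR-∷ʳ-exact (y ∷ w) x =
    trans (startsR-∷ (length w) y (w ++ [ x ]))
          (trans (cong ((y ≡ᵇ 0) ∧_) (startsR-∷ʳ-exact w x)) (sym (∧-assoc (y ≡ᵇ 0) _ _)))

  counted-short : ∀ p r w → length w ≤ r → counted p r w ≡ false
  counted-short p r w h = trans (cong (isPAscent p w ∧_) (startsR-short r w h)) (∧-zeroʳ _)

  counted-∷ʳ-long : ∀ p r w x → r < length w →
                    counted p r (w ++ [ x ]) ≡ counted p r w ∧ (x <ᵇ suc (p + asc w))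
  counted-∷ʳ-long p r w x r<len = begin
    isPAscent p (w ++ [ x ]) ∧ startsR r (w ++ [ x ])
      ≡⟨ cong₂ _∧_ (isPAscent-∷ʳ w x w≢[]) (startsR-++-long r w [ x ] r<len) ⟩
    (isPAscent p w ∧ b) ∧ startsR r w   ≡⟨ ∧-assoc (isPAscent p w) b _ ⟩
    isPAscent p w ∧ (b ∧ startsR r w)   ≡⟨ cong (isPAscent p w ∧_) (∧-comm b _) ⟩
    isPAscent p w ∧ (startsR r w ∧ b)   ≡⟨ ∧-assoc (isPAscent p w) _ b ⟨
    counted p r w ∧ b                   ∎
    where
    open ≡-Reasoning
    b = x <ᵇ suc (p + asc w)
    w≢[] : w ≢ []
    w≢[] refl = contradiction r<len λ ()

  counted-∷ʳ-exact : ∀ p r w x → length w ≡ r → isZeroWord w ≡ false → counted p r (w ++ [ x ]) ≡ false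
  counted-∷ʳ-exact p r w x refl nonzero =
    trans (cong (isPAscent p (w ++ [ x ]) ∧_) (trans (startsR-∷ʳ-exact w x) (cong (_∧ not (x ≡ᵇ 0)) nonzero)))
          (∧-zeroʳ _)

  isZeroWord⇒replicate : ∀ w → isZeroWord w ≡ true → w ≡ replicate (length w) 0
  isZeroWord⇒replicate []      _  = refl
  isZeroWord⇒replicate (y ∷ w) ok =
    cong₂ _∷_ (≡ᵇ-sound (proj₁ (∧-true ok))) (isZeroWord⇒replicate w (proj₂ (∧-true ok)))

  isZeroWord-replicate : ∀ n → isZeroWord (replicate n 0) ≡ true
  isZeroWord-replicate zero    = refl
  isZeroWord-replicate (suc n) = isZeroWord-replicate n

  replicate-≢[] : ∀ {n} {x : ℕ} → 1 ≤ n → replicate n x ≢ []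
  replicate-≢[] {suc n} _ ()

  ascOK-replicate : ∀ p k n → ascOK p 0 k (replicate n 0) ≡ true
  ascOK-replicate p k zero    = refl
  ascOK-replicate p k (suc n) = ascOK-replicate p k n

  isPAscent-replicate : ∀ p n → isPAscent p (replicate n 0) ≡ true
  isPAscent-replicate p zero    = refl
  isPAscent-replicate p (suc n) = ascOK-replicate p 0 n

  asc-replicate : ∀ n → asc (replicate n 0) ≡ 0
  asc-replicate zero          = refl
  asc-replicate (suc zero)    = refl
  asc-replicate (suc (suc n)) = asc-replicate (suc n)

  lastL-replicate : ∀ n → lastL (replicate n 0) ≡ 0
  lastL-replicate zero          = refl
  lastL-replicate (suc zero)    = refl
  lastL-replicate (suc (suc n)) = lastL-replicate (suc n)

  zeros-replicate : ∀ n → zeros (replicate n 0) ≡ n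
  zeros-replicate zero    = refl
  zeros-replicate (suc n) = cong suc (zeros-replicate n)

  counted-replicate-∷ʳ : ∀ p r x → 1 ≤ r →
                     counted p r (replicate r 0 ++ [ x ]) ≡ (x <ᵇ suc (p + 0)) ∧ not (x ≡ᵇ 0)
  counted-replicate-∷ʳ p r x r≥1 = cong₂ _∧_
    (begin
      isPAscent p (replicate r 0 ++ [ x ])
        ≡⟨ isPAscent-∷ʳ (replicate r 0) x (replicate-≢[] r≥1) ⟩
      isPAscent p (replicate r 0) ∧ (x <ᵇ suc (p + asc (replicate r 0)))
        ≡⟨ cong₂ (λ b a → b ∧ (x <ᵇ suc (p + a))) (isPAscent-replicate p r) (asc-replicate r) ⟩
      x <ᵇ suc (p + 0) ∎)
    (begin
      startsR r (replicate r 0 ++ [ x ])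
        ≡⟨ cong (λ m → startsR m (replicate r 0 ++ [ x ])) (length-replicate r) ⟨
      startsR (length (replicate r 0)) (replicate r 0 ++ [ x ])
        ≡⟨ startsR-∷ʳ-exact (replicate r 0) x ⟩
      isZeroWord (replicate r 0) ∧ not (x ≡ᵇ 0)
        ≡⟨ cong (_∧ not (x ≡ᵇ 0)) (isZeroWord-replicate r) ⟩
      not (x ≡ᵇ 0) ∎)
    where open ≡-Reasoning

  length-∈-words : ∀ B n {w} → w ∈ words B n → length w ≡ n
  length-∈-words B zero    (here refl) = refl
  length-∈-words B (suc n) w∈
    with _ , w′∈ , w∈map ← find (∈-concatMap⁻ (λ w → map (_∷ w) (upTo B)) {xs = words B n} w∈)
    with _ , _ , refl ← ∈-map⁻ (_∷ _) w∈map
    = cong suc (length-∈-words B n w′∈)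

open Words

module Sums {c ℓ : Level} (R : CommutativeRing c ℓ) where
  open import Data.Nat as ℕ using (ℕ; zero; suc; _≤′_; _<ᵇ_; ≤′-refl; ≤′-step)
  import Data.Nat.Properties as ℕ
  open import Data.Bool using (true; false; if_then_else_)
  open import Data.List using (List; []; _∷_; _++_; [_]; map; concatMap; filterᵇ; upTo; applyUpTo; length)
  open import Data.List.Properties using (upTo-∷ʳ; map-∘; map-upTo; map-applyUpTo)
  open import Data.List.Membership.Propositional using (_∈_)
  open import Data.List.Membership.Propositional.Properties using (∈-upTo⁻)
  open import Data.List.Relation.Unary.Any using (here; there)
  open import Function using (_∘_)
  open import Relation.Binary.PropositionalEquality as ≡ using (_≡_)
  open CommutativeRing R hiding (zero)
  open GF R using (sumR)
  open import Relation.Binary.Reasoning.Setoid setoid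
  open import Algebra.Properties.CommutativeSemigroup +-commutativeSemigroup using (interchange)
  open import Algebra.Properties.Ring ring using (-‿+-comm; -0#≈0#)

  ∑ : {A : Set} → (A → Carrier) → List A → Carrier
  ∑ f xs = sumR (map f xs)

  private variable A B : Set

  ∑-cong : ∀ {f g : A → Carrier} xs → (∀ {x} → x ∈ xs → f x ≈ g x) → ∑ f xs ≈ ∑ g xs
  ∑-cong []       _   = refl
  ∑-cong (x ∷ xs) f≈g = +-cong (f≈g (here ≡.refl)) (∑-cong xs (f≈g ∘ there))

  ∑-++ : ∀ (f : A → Carrier) xs ys → ∑ f (xs ++ ys) ≈ ∑ f xs + ∑ f ys
  ∑-++ f []       ys = sym (+-identityˡ _)
  ∑-++ f (x ∷ xs) ys = trans (+-congˡ (∑-++ f xs ys)) (sym (+-assoc _ _ _))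

  ∑-0# : ∀ (xs : List A) → ∑ (λ _ → 0#) xs ≈ 0#
  ∑-0# []       = refl
  ∑-0# (x ∷ xs) = trans (+-congˡ (∑-0# xs)) (+-identityʳ 0#)

  ∑-+ : ∀ (f g : A → Carrier) xs → ∑ (λ x → f x + g x) xs ≈ ∑ f xs + ∑ g xs
  ∑-+ f g []       = sym (+-identityʳ 0#)
  ∑-+ f g (x ∷ xs) = trans (+-congˡ (∑-+ f g xs)) (interchange _ _ _ _)

  ∑-*ˡ : ∀ a (f : A → Carrier) xs → ∑ (λ x → a * f x) xs ≈ a * ∑ f xs
  ∑-*ˡ a f []       = sym (zeroʳ a)
  ∑-*ˡ a f (x ∷ xs) = trans (+-congˡ (∑-*ˡ a f xs)) (sym (distribˡ a _ _))

  ∑-neg : ∀ (f : A → Carrier) xs → ∑ (λ x → - f x) xs ≈ - ∑ f xs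
  ∑-neg f []       = sym -0#≈0#
  ∑-neg f (x ∷ xs) = trans (+-congˡ (∑-neg f xs)) (-‿+-comm _ _)

  ∑-sub : ∀ (f g : A → Carrier) xs → ∑ (λ x → f x - g x) xs ≈ ∑ f xs - ∑ g xs
  ∑-sub f g xs = trans (∑-+ f (λ x → - g x) xs) (+-congˡ (∑-neg g xs))

  ∑-filterᵇ : ∀ (f : A → Carrier) P xs → ∑ f (filterᵇ P xs) ≈ ∑ (λ x → if P x then f x else 0#) xs
  ∑-filterᵇ f P []       = refl
  ∑-filterᵇ f P (x ∷ xs) with P x
  ... | true  = +-congˡ (∑-filterᵇ f P xs)
  ... | false = trans (∑-filterᵇ f P xs) (sym (+-identityˡ _))

  ∑-swap : ∀ (f : A → B → Carrier) xs ys →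
           ∑ (λ x → ∑ (f x) ys) xs ≈ ∑ (λ y → ∑ (λ x → f x y) xs) ys
  ∑-swap f []       ys = sym (∑-0# ys)
  ∑-swap f (x ∷ xs) ys = trans (+-congˡ (∑-swap f xs ys)) (sym (∑-+ (f x) _ ys))

  ∑-map : ∀ (f : B → Carrier) (g : A → B) xs → ∑ f (map g xs) ≡ ∑ (λ x → f (g x)) xs
  ∑-map f g xs = ≡.cong sumR (≡.sym (map-∘ xs))

  ∑-concatMap : ∀ (f : B → Carrier) (g : A → List B) xs →
                ∑ f (concatMap g xs) ≈ ∑ (λ x → ∑ f (g x)) xs
  ∑-concatMap f g []       = refl
  ∑-concatMap f g (x ∷ xs) = trans (∑-++ f (g x) (concatMap g xs)) (+-congˡ (∑-concatMap f g xs))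

  ∑-upTo-∷ʳ : ∀ (f : ℕ → Carrier) n → ∑ f (upTo (suc n)) ≈ ∑ f (upTo n) + f n
  ∑-upTo-∷ʳ f n = begin
    ∑ f (upTo (suc n))        ≡⟨ ≡.cong (∑ f) (upTo-∷ʳ n) ⟨
    ∑ f (upTo n ++ [ n ])     ≈⟨ ∑-++ f (upTo n) [ n ] ⟩
    ∑ f (upTo n) + (f n + 0#) ≈⟨ +-congˡ (+-identityʳ (f n)) ⟩
    ∑ f (upTo n) + f n        ∎

  ∑-upTo-suc : ∀ (f : ℕ → Carrier) n → ∑ f (upTo (suc n)) ≡ f 0 + ∑ (λ x → f (suc x)) (upTo n)
  ∑-upTo-suc f n = ≡.cong (λ xs → f 0 + sumR xs)
    (≡.trans (map-applyUpTo suc f n) (≡.sym (map-upTo (λ x → f (suc x)) n)))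

  ∑-upTo-truncate : ∀ (f : ℕ → Carrier) {N B} → N ≤′ B →
                    ∑ (λ x → if x <ᵇ N then f x else 0#) (upTo B) ≈ ∑ f (upTo N)
  ∑-upTo-truncate f {N} ≤′-refl =
    ∑-cong (upTo N) λ {x} x∈ → reflexive (≡.cong (λ b → if b then f x else 0#) (<ᵇ-true (∈-upTo⁻ x∈)))
  ∑-upTo-truncate f {N} (≤′-step {B} N≤′B) = begin
    ∑ h (upTo (suc B))  ≈⟨ ∑-upTo-∷ʳ h B ⟩
    ∑ h (upTo B) + h B
      ≡⟨ ≡.cong (λ b → ∑ h (upTo B) + (if b then f B else 0#)) (<ᵇ-false (ℕ.≤′⇒≤ N≤′B)) ⟩
    ∑ h (upTo B) + 0#   ≈⟨ +-identityʳ _ ⟩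
    ∑ h (upTo B)        ≈⟨ ∑-upTo-truncate f N≤′B ⟩
    ∑ f (upTo N)        ∎
    where h = λ x → if x <ᵇ N then f x else 0#

  ∑-words-∷ : ∀ (F : List ℕ → Carrier) B n →
              ∑ F (words B (suc n)) ≈ ∑ (λ w → ∑ (λ x → F (x ∷ w)) (upTo B)) (words B n)
  ∑-words-∷ F B n = trans (∑-concatMap F _ (words B n))
    (∑-cong (words B n) λ {w} _ → reflexive (∑-map F (_∷ w) (upTo B)))

  ∑-words-∷ʳ : ∀ (F : List ℕ → Carrier) B n →
               ∑ F (words B (suc n)) ≈ ∑ (λ w → ∑ (λ x → F (w ++ [ x ])) (upTo B)) (words B n)
  ∑-words-∷ʳ F B zero    = ∑-words-∷ F B zero
  ∑-words-∷ʳ F B (suc n) = begin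
    ∑ F (words B (suc (suc n)))
      ≈⟨ ∑-words-∷ F B (suc n) ⟩
    ∑ (λ w → ∑ (λ x → F (x ∷ w)) (upTo B)) (words B (suc n))
      ≈⟨ ∑-words-∷ʳ _ B n ⟩
    ∑ (λ w → ∑ (λ y → ∑ (λ x → F (x ∷ w ++ [ y ])) (upTo B)) (upTo B)) (words B n)
      ≈⟨ ∑-cong (words B n) (λ {w} _ → ∑-swap (λ y x → F (x ∷ w ++ [ y ])) (upTo B) (upTo B)) ⟩
    ∑ (λ w → ∑ (λ x → ∑ (λ y → F (x ∷ w ++ [ y ])) (upTo B)) (upTo B)) (words B n)
      ≈⟨ ∑-words-∷ _ B n ⟨
    ∑ (λ w → ∑ (λ y → F (w ++ [ y ])) (upTo B)) (words B (suc n)) ∎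

  ∑-words-alphabet : ∀ (F : List ℕ → Carrier) B n → (∀ {w} → length w ≡ n → B ∈ w → F w ≈ 0#) →
                     ∑ F (words (suc B) n) ≈ ∑ F (words B n)
  ∑-words-alphabet F B zero    _      = refl
  ∑-words-alphabet F B (suc n) F-vanishes = begin
    ∑ F (words (suc B) (suc n))
      ≈⟨ ∑-words-∷ F (suc B) n ⟩
    ∑ (λ w → ∑ (λ x → F (x ∷ w)) (upTo (suc B))) (words (suc B) n)
      ≈⟨ ∑-words-alphabet _ B n (λ len B∈w →
           trans (∑-cong (upTo (suc B)) (λ _ → F-vanishes (≡.cong suc len) (there B∈w))) (∑-0# (upTo (suc B)))) ⟩
    ∑ (λ w → ∑ (λ x → F (x ∷ w)) (upTo (suc B))) (words B n)
      ≈⟨ ∑-cong (words B n) (λ {w} w∈ → begin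
           ∑ (λ x → F (x ∷ w)) (upTo (suc B))       ≈⟨ ∑-upTo-∷ʳ _ B ⟩
           ∑ (λ x → F (x ∷ w)) (upTo B) + F (B ∷ w)
             ≈⟨ +-congˡ (F-vanishes (≡.cong suc (length-∈-words B n w∈)) (here ≡.refl)) ⟩
           ∑ (λ x → F (x ∷ w)) (upTo B) + 0#        ≈⟨ +-identityʳ _ ⟩
           ∑ (λ x → F (x ∷ w)) (upTo B)             ∎) ⟩
    ∑ (λ w → ∑ (λ x → F (x ∷ w)) (upTo B)) (words B n)
      ≈⟨ ∑-words-∷ F B n ⟨
    ∑ F (words B (suc n)) ∎

  ∑-words-isZeroWord : ∀ a B n → ∑ (λ w → if isZeroWord w then a else 0#) (words (suc B) n) ≈ a
  ∑-words-isZeroWord a B zero    = +-identityʳ a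
  ∑-words-isZeroWord a B (suc n) = begin
    ∑ F (words (suc B) (suc n))                          ≈⟨ ∑-words-∷ F (suc B) n ⟩
    ∑ (λ w → ∑ (λ x → F (x ∷ w)) (upTo (suc B))) (words (suc B) n)
      ≈⟨ ∑-cong (words (suc B) n) (λ {w} _ → begin
           ∑ (λ x → F (x ∷ w)) (upTo (suc B))            ≡⟨ ∑-upTo-suc (λ x → F (x ∷ w)) B ⟩
           F w + ∑ (λ _ → 0#) (upTo B)                   ≈⟨ +-congˡ (∑-0# (upTo B)) ⟩
           F w + 0#                                      ≈⟨ +-identityʳ _ ⟩
           F w                                           ∎) ⟩
    ∑ F (words (suc B) n)                                ≈⟨ ∑-words-isZeroWord a B n ⟩
    a                                                    ∎
    where F = λ w → if isZeroWord w then a else 0#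

module GeometricSum {c ℓ′ : Level} (R : CommutativeRing c ℓ′) (u v a : CommutativeRing.Carrier R) (ℓ : ℕ) where
  open import Data.Nat as ℕ using (ℕ; zero; suc; _≤_; _≤′_; _<ᵇ_; _≡ᵇ_; ≤′-refl; ≤′-step)
  import Data.Nat.Properties as ℕ
  open import Data.List using (upTo)
  open import Relation.Binary.PropositionalEquality as ≡ using (_≡_)
  open CommutativeRing R hiding (zero)
  open GF R using (_^_)
  open Sums R
  open DifferenceRingSolver R using (solve; _:=_; _:+_; _:*_; _:-_; :0; :1)
  open import Relation.Binary.Reasoning.Setoid setoid

  -- For a = z, the factor by which appending x to a word with last letter ℓ multiplies its
  -- weight, except that v ^ x replaces v ^ ℓ; a = 0# excludes the letter 0.
  letterWeight : ℕ → Carrier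
  letterWeight x = u ^ 𝟙 (ℓ <ᵇ x) * (v ^ x * a ^ 𝟙 (x ≡ᵇ 0))

  geometric-≤ : ∀ M → M ≤ ℓ → (v - 1#) * ∑ letterWeight (upTo (suc M)) ≈ (v - 1#) * a - v + v ^ suc M
  geometric-≤ zero    _     = solve 2 (λ v a → (v :- :1) :* (:1 :* (:1 :* (a :* :1)) :+ :0)
                                          := (v :- :1) :* a :- v :+ v :* :1) refl v a
  geometric-≤ (suc M) M<ℓ = begin
    (v - 1#) * ∑ letterWeight (upTo (suc (suc M)))
      ≈⟨ *-congˡ (∑-upTo-∷ʳ letterWeight (suc M)) ⟩
    (v - 1#) * (∑ letterWeight (upTo (suc M)) + letterWeight (suc M))
      ≈⟨ distribˡ (v - 1#) _ _ ⟩
    (v - 1#) * ∑ letterWeight (upTo (suc M)) + (v - 1#) * letterWeight (suc M)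
      ≈⟨ +-cong (geometric-≤ M (ℕ.<⇒≤ M<ℓ))
                (*-congˡ (reflexive (≡.cong (λ b → u ^ 𝟙 b * (v ^ suc M * 1#)) (<ᵇ-false M<ℓ)))) ⟩
    ((v - 1#) * a - v + v ^ suc M) + (v - 1#) * (1# * (v ^ suc M * 1#))
      ≈⟨ solve 3 (λ v a V → ((v :- :1) :* a :- v :+ V) :+ (v :- :1) :* (:1 :* (V :* :1))
                          := (v :- :1) :* a :- v :+ v :* V) refl v a (v ^ suc M) ⟩
    (v - 1#) * a - v + v ^ suc (suc M) ∎

  geometric : ∀ {K} → ℓ ≤′ K →
              (v - 1#) * ∑ letterWeight (upTo (suc K)) ≈ (v - 1#) * a - v + v ^ suc ℓ + u * (v ^ suc K - v ^ suc ℓ)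
  geometric ≤′-refl = trans (geometric-≤ ℓ ℕ.≤-refl)
    (solve 4 (λ v a u L → (v :- :1) :* a :- v :+ L := (v :- :1) :* a :- v :+ L :+ u :* (L :- L)) refl v a u (v ^ suc ℓ))
  geometric (≤′-step {K} ℓ≤′K) = begin
    (v - 1#) * ∑ letterWeight (upTo (suc (suc K)))
      ≈⟨ *-congˡ (∑-upTo-∷ʳ letterWeight (suc K)) ⟩
    (v - 1#) * (∑ letterWeight (upTo (suc K)) + letterWeight (suc K))
      ≈⟨ distribˡ (v - 1#) _ _ ⟩
    (v - 1#) * ∑ letterWeight (upTo (suc K)) + (v - 1#) * letterWeight (suc K)
      ≈⟨ +-cong (geometric ℓ≤′K)
                (*-congˡ (reflexive (≡.cong (λ b → u ^ 𝟙 b * (v ^ suc K * 1#)) (<ᵇ-true (ℕ.s≤s (ℕ.≤′⇒≤ ℓ≤′K)))))) ⟩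
    ((v - 1#) * a - v + L + u * (V - L)) + (v - 1#) * ((u * 1#) * (V * 1#))
      ≈⟨ solve 5 (λ v a u L V → ((v :- :1) :* a :- v :+ L :+ u :* (V :- L)) :+ (v :- :1) :* ((u :* :1) :* (V :* :1))
                          := (v :- :1) :* a :- v :+ L :+ u :* (v :* V :- L)) refl v a u L V ⟩
    (v - 1#) * a - v + L + u * (v ^ suc (suc K) - L) ∎
    where L = v ^ suc ℓ
          V = v ^ suc K

module Recurrence {c ℓ′ : Level} (R : CommutativeRing c ℓ′) (p r : ℕ) (r≥1 : r ≥ 1)
                  (z : CommutativeRing.Carrier R) where
  open import Data.Nat as ℕ
    using (ℕ; zero; suc; _≤_; _<_; _≤′_; _<ᵇ_; _≡ᵇ_; ≤′-refl; ≤′-step; z≤n; s≤s)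
  import Data.Nat.Properties as ℕ
  open import Data.Bool using (Bool; true; false; if_then_else_; _∧_)
  open import Data.Bool.Properties using (∧-identityʳ; ∧-zeroʳ)
  open import Data.List using (List; []; _∷_; _++_; [_]; upTo; length; replicate)
  open import Data.List.Properties using (length-replicate; length-++)
  open import Data.List.Membership.Propositional using (_∈_)
  open import Relation.Binary.Definitions using (tri<; tri≈; tri>)
  open import Relation.Binary.PropositionalEquality as ≡ using (_≡_; _≢_)
  open import Data.Product using (proj₁)
  open CommutativeRing R hiding (zero)
  open GF R
  open Sums R
  open DifferenceRingSolver R using (solve; _:=_; _:+_; _:*_; _:-_; :0; :1)
  open GeometricSum R using (letterWeight; geometric)
  open import Algebra.Properties.Semiring.Exp semiring using (^-homo-*)
  open import Algebra.Properties.CommutativeSemiring.Exp commutativeSemiring using (^-distrib-*)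
  open import Relation.Binary.Reasoning.Setoid setoid

  1#^n≈1# : ∀ n → 1# ^ n ≈ 1#
  1#^n≈1# zero    = refl
  1#^n≈1# (suc n) = trans (*-identityˡ _) (1#^n≈1# n)

  if-congˡ : ∀ {a a′} b → a ≈ a′ → (if b then a else 0#) ≈ (if b then a′ else 0#)
  if-congˡ true  a≈a′ = a≈a′
  if-congˡ false _    = refl

  weight : Carrier → Carrier → List ℕ → Carrier
  weight u v w = u ^ asc w * (v ^ lastL w * z ^ zeros w)

  term : Carrier → Carrier → List ℕ → Carrier
  term u v w = if counted p r w then weight u v w else 0#

  term-uncounted : ∀ u v w → counted p r w ≡ false → term u v w ≈ 0#
  term-uncounted u v w eq = reflexive (≡.cong (λ b → if b then weight u v w else 0#) eq)

  term-counted : ∀ u v w → counted p r w ≡ true → term u v w ≈ weight u v w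
  term-counted u v w eq = reflexive (≡.cong (λ b → if b then weight u v w else 0#) eq)

  weight-∷ʳ : ∀ u v w x → w ≢ [] →
              weight u v (w ++ [ x ]) ≈ (u ^ asc w * z ^ zeros w) * letterWeight u v z (lastL w) x
  weight-∷ʳ u v w x w≢[] = begin
    weight u v (w ++ [ x ])
      ≡⟨ ≡.cong₂ (λ a Z → u ^ a * (v ^ lastL (w ++ [ x ]) * z ^ Z)) (asc-∷ʳ w x w≢[]) (zeros-∷ʳ w x) ⟩
    u ^ (asc w ℕ.+ i) * (v ^ lastL (w ++ [ x ]) * z ^ (zeros w ℕ.+ j))
      ≈⟨ *-cong (^-homo-* u (asc w) i) (*-cong (reflexive (≡.cong (v ^_) (lastL-∷ʳ w x))) (^-homo-* z (zeros w) j)) ⟩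
    (u ^ asc w * u ^ i) * (v ^ x * (z ^ zeros w * z ^ j))
      ≈⟨ solve 5 (λ U I V Z J → (U :* I) :* (V :* (Z :* J)) := (U :* Z) :* (I :* (V :* J)))
               refl (u ^ asc w) (u ^ i) (v ^ x) (z ^ zeros w) (z ^ j) ⟩
    (u ^ asc w * z ^ zeros w) * letterWeight u v z (lastL w) x ∎
    where i = 𝟙 (lastL w <ᵇ x)
          j = 𝟙 (x ≡ᵇ 0)

  G-≈-∑ : ∀ u v n {B} → suc (p ℕ.+ n) ≤′ B → G p r u v z n ≈ ∑ (term u v) (words B n)
  G-≈-∑ u v n ≤′-refl = ∑-filterᵇ (weight u v) (counted p r) (words (suc (p ℕ.+ n)) n)
  G-≈-∑ u v n (≤′-step {B} large) = trans (G-≈-∑ u v n large) (sym (∑-words-alphabet (term u v) B n vanish))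
    where
    vanish : ∀ {w} → length w ≡ n → B ∈ w → term u v w ≈ 0#
    vanish {w} ≡.refl B∈w = term-uncounted u v w (counted-∋-large {p} {r} (ℕ.≤′⇒≤ large) B∈w)

  module _ (u v : Carrier) where

    k₀ k₁ k₂ c₀ : Carrier
    k₀ = v * (1# - u)
    k₁ = (v - 1#) * z - v
    k₂ = u * v ^ suc p
    c₀ = z ^ r * (u * (v * (v ^ p - 1#)))

    extensions : ℕ → List ℕ → Carrier
    extensions B w = ∑ (λ x → term u v (w ++ [ x ])) (upTo B)

    -- The share of the identity at t^(n+1) carried by the words with prefix w (of length n);
    -- m says whether w is the prefix 0^r, which carries the monomial term.
    RecurrenceAt : ℕ → Bool → List ℕ → Set ℓ′
    RecurrenceAt B m w = (v - 1#) * extensions B w - k₀ * term u v w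
                         ≈ (if m then c₀ else 0#) + (k₁ * term u 1# w + k₂ * term (u * v) 1# w)

    recurrenceAt-trivial : ∀ {B m} w → m ≡ false → counted p r w ≡ false →
                        (∀ x → counted p r (w ++ [ x ]) ≡ false) → RecurrenceAt B m w
    recurrenceAt-trivial {B} w ≡.refl w-uncounted extensions-uncounted = begin
      (v - 1#) * extensions B w - k₀ * term u v w
        ≈⟨ +-cong (*-congˡ (trans (∑-cong (upTo B) (λ {x} _ → term-uncounted u v (w ++ [ x ]) (extensions-uncounted x)))
                                  (∑-0# (upTo B))))
                  (-‿cong (*-congˡ (term-uncounted u v w w-uncounted))) ⟩
      (v - 1#) * 0# - k₀ * 0#
        ≈⟨ solve 4 (λ v k₀ k₁ k₂ → (v :- :1) :* :0 :- k₀ :* :0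
                                   := :0 :+ (k₁ :* :0 :+ k₂ :* :0)) refl v k₀ k₁ k₂ ⟩
      0# + (k₁ * 0# + k₂ * 0#)
        ≈⟨ +-congˡ (+-cong (*-congˡ (term-uncounted u 1# w w-uncounted))
                           (*-congˡ (term-uncounted (u * v) 1# w w-uncounted))) ⟨
      0# + (k₁ * term u 1# w + k₂ * term (u * v) 1# w) ∎

    zeroWord-extension : ∀ x → term u v (replicate r 0 ++ [ x ])
                               ≈ (if x <ᵇ suc (p ℕ.+ 0) then z ^ r * letterWeight u v 0# 0 x else 0#)
    zeroWord-extension zero = begin
      term u v (replicate r 0 ++ [ 0 ])
        ≈⟨ term-uncounted u v (replicate r 0 ++ [ 0 ]) (counted-replicate-∷ʳ p r 0 r≥1) ⟩
      0#
        ≈⟨ solve 1 (λ Z → Z :* (:1 :* (:1 :* (:0 :* :1))) := :0) refl (z ^ r) ⟨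
      z ^ r * letterWeight u v 0# 0 0 ∎
    zeroWord-extension (suc m) = begin
      term u v (0ʳ ++ [ suc m ])
        ≡⟨ ≡.cong (λ b → if b then weight u v (0ʳ ++ [ suc m ]) else 0#)
                  (≡.trans (counted-replicate-∷ʳ p r (suc m) r≥1) (∧-identityʳ _)) ⟩
      (if m <ᵇ p ℕ.+ 0 then weight u v (0ʳ ++ [ suc m ]) else 0#)
        ≈⟨ if-congˡ (m <ᵇ p ℕ.+ 0) (begin
             weight u v (0ʳ ++ [ suc m ])
               ≈⟨ weight-∷ʳ u v 0ʳ (suc m) (replicate-≢[] r≥1) ⟩
             (u ^ asc 0ʳ * z ^ zeros 0ʳ) * letterWeight u v z (lastL 0ʳ) (suc m)
               ≡⟨ ≡.cong₂ (λ a ℓ → (u ^ a * z ^ zeros 0ʳ) * letterWeight u v z ℓ (suc m))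
                          (asc-replicate r) (lastL-replicate r) ⟩
             (1# * z ^ zeros 0ʳ) * letterWeight u v 0# 0 (suc m)
               ≈⟨ *-congʳ (trans (*-identityˡ _) (reflexive (≡.cong (z ^_) (zeros-replicate r)))) ⟩
             z ^ r * letterWeight u v 0# 0 (suc m) ∎) ⟩
      (if m <ᵇ p ℕ.+ 0 then z ^ r * letterWeight u v 0# 0 (suc m) else 0#) ∎
      where 0ʳ = replicate r 0

    recurrenceAt-zeroWord : ∀ {B m} → p < B → m ≡ true → RecurrenceAt B m (replicate r 0)
    recurrenceAt-zeroWord {B} p<B ≡.refl = begin
      (v - 1#) * extensions B 0ʳ - k₀ * term u v 0ʳ
        ≈⟨ +-cong (*-congˡ extensions≈) (-‿cong (*-congˡ (term-uncounted u v 0ʳ short))) ⟩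
      (v - 1#) * (z ^ r * ∑ g (upTo (suc (p ℕ.+ 0)))) - k₀ * 0#
        ≈⟨ +-congʳ (trans (x∙yz≈y∙xz _ _ _) (*-congˡ (geometric u v 0# 0 {p ℕ.+ 0} (ℕ.≤⇒≤′ z≤n)))) ⟩
      z ^ r * ((v - 1#) * 0# - v + v ^ 1 + u * (v ^ suc (p ℕ.+ 0) - v ^ 1)) - k₀ * 0#
        ≡⟨ ≡.cong (λ n → z ^ r * ((v - 1#) * 0# - v + v ^ 1 + u * (v * v ^ n - v ^ 1)) - k₀ * 0#)
                  (ℕ.+-identityʳ p) ⟩
      z ^ r * ((v - 1#) * 0# - v + v * 1# + u * (v * v ^ p - v * 1#)) - k₀ * 0#
        ≈⟨ solve 7 (λ Z v u P k₀ k₁ k₂ →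
             Z :* ((v :- :1) :* :0 :- v :+ v :* :1 :+ u :* (v :* P :- v :* :1)) :- k₀ :* :0
             := Z :* (u :* (v :* (P :- :1))) :+ (k₁ :* :0 :+ k₂ :* :0))
           refl (z ^ r) v u (v ^ p) k₀ k₁ k₂ ⟩
      c₀ + (k₁ * 0# + k₂ * 0#)
        ≈⟨ +-congˡ (+-cong (*-congˡ (term-uncounted u 1# 0ʳ short)) (*-congˡ (term-uncounted (u * v) 1# 0ʳ short))) ⟨
      c₀ + (k₁ * term u 1# 0ʳ + k₂ * term (u * v) 1# 0ʳ) ∎
      where
      0ʳ = replicate r 0
      g  = letterWeight u v 0# 0
      open import Algebra.Properties.CommutativeSemigroup *-commutativeSemigroup using (x∙yz≈y∙xz)
      short : counted p r 0ʳ ≡ false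
      short = counted-short p r 0ʳ (ℕ.≤-reflexive (length-replicate r))
      extensions≈ : extensions B 0ʳ ≈ z ^ r * ∑ g (upTo (suc (p ℕ.+ 0)))
      extensions≈ = begin
        extensions B 0ʳ
          ≈⟨ ∑-cong (upTo B) (λ {x} _ → zeroWord-extension x) ⟩
        ∑ (λ x → if x <ᵇ suc (p ℕ.+ 0) then z ^ r * g x else 0#) (upTo B)
          ≈⟨ ∑-upTo-truncate (λ x → z ^ r * g x)
                             (ℕ.≤⇒≤′ (≡.subst (_< B) (≡.sym (ℕ.+-identityʳ p)) p<B)) ⟩
        ∑ (λ x → z ^ r * g x) (upTo (suc (p ℕ.+ 0)))
          ≈⟨ ∑-*ˡ (z ^ r) g (upTo (suc (p ℕ.+ 0))) ⟩
        z ^ r * ∑ g (upTo (suc (p ℕ.+ 0))) ∎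

    recurrenceAt-long : ∀ {B m} y l → p ℕ.+ length (y ∷ l) < B → r < length (y ∷ l) → m ≡ false →
                        counted p r (y ∷ l) ≡ true → RecurrenceAt B m (y ∷ l)
    recurrenceAt-long {B} y l large long ≡.refl w-counted = begin
      (v - 1#) * extensions B w - k₀ * term u v w
        ≈⟨ +-cong (*-congˡ extensions≈) (-‿cong (*-congˡ (term-counted u v w w-counted))) ⟩
      (v - 1#) * ((U * Zp) * ∑ g (upTo (suc K))) - k₀ * (U * (L * Zp))
        ≈⟨ +-congʳ (trans (x∙yz≈y∙xz _ _ _) (*-congˡ (geometric u v z ℓ (ℕ.≤⇒≤′ ℓ≤K)))) ⟩
      (U * Zp) * ((v - 1#) * z - v + v * L + u * (v * v ^ (p ℕ.+ a) - v * L)) - k₀ * (U * (L * Zp))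
        ≈⟨ +-congʳ (*-congˡ (+-congˡ (*-congˡ (+-congʳ (*-congˡ (^-homo-* v p a)))))) ⟩
      (U * Zp) * ((v - 1#) * z - v + v * L + u * (v * (P * A) - v * L)) - k₀ * (U * (L * Zp))
        ≈⟨ solve 8 (λ U Zp L P A u v z →
             (U :* Zp) :* ((v :- :1) :* z :- v :+ v :* L :+ u :* (v :* (P :* A) :- v :* L))
               :- v :* (:1 :- u) :* (U :* (L :* Zp))
             := :0 :+ (((v :- :1) :* z :- v) :* (U :* (:1 :* Zp))
                               :+ u :* (v :* P) :* ((U :* A) :* (:1 :* Zp))))
           refl U Zp L P A u v z ⟩
      0# + (k₁ * (U * (1# * Zp)) + k₂ * ((U * A) * (1# * Zp)))
        ≈⟨ +-congˡ (+-cong (*-congˡ (trans (term-counted u 1# w w-counted) (*-congˡ (*-congʳ (1#^n≈1# ℓ)))))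
                           (*-congˡ (trans (term-counted (u * v) 1# w w-counted)
                                           (*-cong (^-distrib-* u v a) (*-congʳ (1#^n≈1# ℓ)))))) ⟨
      0# + (k₁ * term u 1# w + k₂ * term (u * v) 1# w) ∎
      where
      open import Algebra.Properties.CommutativeSemigroup *-commutativeSemigroup using (x∙yz≈y∙xz)
      w = y ∷ l
      a = asc w
      ℓ = lastL w
      K = p ℕ.+ a
      U = u ^ a
      Zp = z ^ zeros w
      L = v ^ ℓ
      P = v ^ p
      A = v ^ a
      g = letterWeight u v z ℓ
      ℓ≤K : ℓ ≤ K
      ℓ≤K = isPAscent-lastL≤ w (proj₁ (∧-true w-counted))
      extension : ∀ x → term u v (w ++ [ x ]) ≈ (if x <ᵇ suc K then (U * Zp) * g x else 0#)
      extension x = begin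
        term u v (w ++ [ x ])
          ≡⟨ ≡.cong (λ b → if b then weight u v (w ++ [ x ]) else 0#)
                    (≡.trans (counted-∷ʳ-long p r w x long) (≡.cong (_∧ (x <ᵇ suc K)) w-counted)) ⟩
        (if x <ᵇ suc K then weight u v (w ++ [ x ]) else 0#)
          ≈⟨ if-congˡ (x <ᵇ suc K) (weight-∷ʳ u v w x (λ ())) ⟩
        (if x <ᵇ suc K then (U * Zp) * g x else 0#) ∎
      extensions≈ : extensions B w ≈ (U * Zp) * ∑ g (upTo (suc K))
      extensions≈ = begin
        extensions B w
          ≈⟨ ∑-cong (upTo B) (λ {x} _ → extension x) ⟩
        ∑ (λ x → if x <ᵇ suc K then (U * Zp) * g x else 0#) (upTo B)
          ≈⟨ ∑-upTo-truncate (λ x → (U * Zp) * g x)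
                             (ℕ.≤⇒≤′ (ℕ.≤-<-trans (ℕ.+-monoʳ-≤ p (asc≤length w)) large)) ⟩
        ∑ (λ x → (U * Zp) * g x) (upTo (suc K))
          ≈⟨ ∑-*ˡ (U * Zp) g (upTo (suc K)) ⟩
        (U * Zp) * ∑ g (upTo (suc K)) ∎

    recurrenceAt : ∀ {B n} w → length w ≡ n → p ℕ.+ n < B → RecurrenceAt B ((r ≡ᵇ n) ∧ isZeroWord w) w
    recurrenceAt {B} w ≡.refl large with ℕ.<-cmp (length w) r
    ... | tri< len<r _ _ =
      recurrenceAt-trivial {B} w
        (≡.cong (_∧ isZeroWord w) (≡ᵇ-false (λ r≡len → ℕ.<-irrefl (≡.sym r≡len) len<r)))
        (counted-short p r w (ℕ.<⇒≤ len<r))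
        (λ x → counted-short p r (w ++ [ x ])
                 (ℕ.≤-trans (ℕ.≤-reflexive (≡.trans (length-++ w) (ℕ.+-comm _ 1))) len<r))
    ... | tri≈ _ len≡r _ with isZeroWord w in zero?
    ...   | true  = ≡.subst (RecurrenceAt B _) (≡.sym w≡0ʳ)
                      (recurrenceAt-zeroWord {B} (ℕ.≤-<-trans (ℕ.m≤m+n p _) large)
                         (≡.cong (_∧ true) (≡.trans (≡.cong (r ≡ᵇ_) len≡r) (≡ᵇ-refl r))))
      where
      w≡0ʳ : w ≡ replicate r 0
      w≡0ʳ = ≡.trans (isZeroWord⇒replicate w zero?) (≡.cong (λ k → replicate k 0) len≡r)
    ...   | false = recurrenceAt-trivial {B} w (∧-zeroʳ _) (counted-short p r w (ℕ.≤-reflexive len≡r))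
                      (λ x → counted-∷ʳ-exact p r w x len≡r zero?)
    recurrenceAt {B} (y ∷ l) ≡.refl large | tri> _ _ r<len = long (counted p r (y ∷ l)) ≡.refl
      where
      not-r : (r ≡ᵇ length (y ∷ l)) ≡ false
      not-r = ≡ᵇ-false (λ r≡len → ℕ.<-irrefl r≡len r<len)
      long : ∀ b → counted p r (y ∷ l) ≡ b →
             RecurrenceAt B ((r ≡ᵇ length (y ∷ l)) ∧ isZeroWord (y ∷ l)) (y ∷ l)
      long true  w-counted   = recurrenceAt-long {B} y l large r<len (≡.cong (_∧ isZeroWord (y ∷ l)) not-r) w-counted
      long false w-uncounted = recurrenceAt-trivial {B} (y ∷ l) (≡.cong (_∧ isZeroWord (y ∷ l)) not-r) w-uncounted
                           (λ x → ≡.trans (counted-∷ʳ-long p r (y ∷ l) x r<len) (≡.cong (_∧ _) w-uncounted))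

    recurrence : ∀ n →
      (v - 1#) * G p r u v z n - k₀ * shiftT (G p r u v z) n
        ≈ monoT (suc r) c₀ n + (k₁ * shiftT (G p r u 1# z) n + k₂ * shiftT (G p r (u * v) 1# z) n)
    recurrence zero = begin
      (v - 1#) * G p r u v z 0 - k₀ * 0#
        ≈⟨ +-congʳ (*-congˡ (trans (G-≈-∑ u v 0 ≤′-refl)
                                   (trans (+-identityʳ _) (term-uncounted u v [] (counted-short p r [] z≤n))))) ⟩
      (v - 1#) * 0# - k₀ * 0#
        ≈⟨ solve 4 (λ v k₀ k₁ k₂ → (v :- :1) :* :0 :- k₀ :* :0
                                   := :0 :+ (k₁ :* :0 :+ k₂ :* :0)) refl v k₀ k₁ k₂ ⟩
      0# + (k₁ * 0# + k₂ * 0#) ∎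
    recurrence (suc n) = begin
      (v - 1#) * G p r u v z (suc n) - k₀ * G p r u v z n
        ≈⟨ +-cong (*-congˡ (trans (G-≈-∑ u v (suc n) ≤′-refl) (∑-words-∷ʳ (term u v) B n)))
                  (-‿cong (*-congˡ (G-≈-∑ u v n B-large))) ⟩
      (v - 1#) * ∑ (extensions B) W - k₀ * ∑ (term u v) W
        ≈⟨ +-cong (∑-*ˡ (v - 1#) (extensions B) W) (-‿cong (∑-*ˡ k₀ (term u v) W)) ⟨
      ∑ (λ w → (v - 1#) * extensions B w) W - ∑ (λ w → k₀ * term u v w) W
        ≈⟨ ∑-sub _ _ W ⟨
      ∑ (λ w → (v - 1#) * extensions B w - k₀ * term u v w) W
        ≈⟨ ∑-cong W (λ {w} w∈ → recurrenceAt w (length-∈-words B n w∈) p+n<B) ⟩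
      ∑ (λ w → M w + (k₁ * term u 1# w + k₂ * term (u * v) 1# w)) W
        ≈⟨ ∑-+ M _ W ⟩
      ∑ M W + ∑ (λ w → k₁ * term u 1# w + k₂ * term (u * v) 1# w) W
        ≈⟨ +-cong ∑M (trans (∑-+ _ _ W) (+-cong (∑-*ˡ k₁ (term u 1#) W) (∑-*ˡ k₂ (term (u * v) 1#) W))) ⟩
      (if r ≡ᵇ n then c₀ else 0#) + (k₁ * ∑ (term u 1#) W + k₂ * ∑ (term (u * v) 1#) W)
        ≈⟨ +-congˡ (+-cong (*-congˡ (G-≈-∑ u 1# n B-large)) (*-congˡ (G-≈-∑ (u * v) 1# n B-large))) ⟨
      (if r ≡ᵇ n then c₀ else 0#) + (k₁ * G p r u 1# z n + k₂ * G p r (u * v) 1# z n) ∎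
      where
      B = suc (p ℕ.+ suc n)
      W = words B n
      M = λ w → if (r ≡ᵇ n) ∧ isZeroWord w then c₀ else 0#
      p+n<B : p ℕ.+ n < B
      p+n<B = s≤s (ℕ.+-monoʳ-≤ p (ℕ.n≤1+n n))
      B-large : suc (p ℕ.+ n) ≤′ B
      B-large = ℕ.≤⇒≤′ p+n<B
      ∑M : ∑ M W ≈ (if r ≡ᵇ n then c₀ else 0#)
      ∑M with r ≡ᵇ n
      ... | true  = ∑-words-isZeroWord c₀ (p ℕ.+ suc n) n
      ... | false = ∑-0# W

lemma2p1 : ∀ {c ℓ : Level} (R : CommutativeRing c ℓ) (p r : ℕ) → p ≥ 1 → r ≥ 1 →
    let open CommutativeRing R
        open GF R
    in ∀ (u v z : Carrier) (n : ℕ) →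
      (v - 1#) * G p r u v z n - (v * (1# - u)) * shiftT (G p r u v z) n
        ≈ monoT (suc r) ((z ^ r) * (u * (v * ((v ^ p) - 1#)))) n
          + (((v - 1#) * z - v) * shiftT (G p r u 1# z) n
          + (u * (v ^ suc p)) * shiftT (G p r (u * v) 1# z) n)
lemma2p1 R p r _ r≥1 u v z = Recurrence.recurrence R p r r≥1 z u v
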